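{- Let $G = (V,E)$ be a finite graph and let $(\mathcal{X},\mathcal{T})$ be a non-repeated tree decomposition of $G$ of width $h$. Let $\mathcal T'$ be a subtree (connected subgraph) of $\mathcal{T}$, let $\mathcal X|_{\mathcal T'}$ denote the set of nodes of $\mathcal T'$, and let $V|_{\mathcal T'}=\bigcup_{Z\in \mathcal X|_{\mathcal T'}} Z$. Then $$\frac{\bigl|V|_{\mathcal{T}'}\bigr|}{h+1} \leq \bigl|\mathcal X|_{\mathcal{T}'}\bigr| \leq \bigl|V|_{\mathcal{T}'}\bigr|.$$
   Context: A tree decomposition of $G$ is a pair $(\mathcal X,\mathcal T)$ where $\mathcal X=(X_1,\dots,X_m)$ is a family of subsets of $V$ and $\mathcal T$ is a tree or forest whose nodes are the $X_i$, such that: every vertex lies in some $X_i$; every edge has both endpoints in some $X_i$; for every $v\in V$ the nodes containing $v$ form a connected subset of $\mathcal T$. Its width is $\max_i|X_i|-1$. It is non-repeated if no $X_i$ is empty and there is no edge $(X_i,X_j)$ of $\mathcal T$ with $X_i\subseteq X_j$. -}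

module Defs where

open import Data.Nat using (ℕ; _⊔_; _∸_; _≤_)
open import Data.Fin using (Fin)
open import Data.Fin.Subset using (Subset; _∈_; _⊆_; ∣_∣)
open import Data.Fin.Subset.Properties using (_∈?_)
open import Data.Fin.Properties using (any?)
open import Data.List using (List; []; _∷_; _++_; [_]; length; map; foldr; allFin)
open import Data.List.Relation.Unary.Linked using (Linked)
open import Data.List.Relation.Unary.Unique.Propositional using (Unique)
open import Data.Vec using (tabulate)
open import Data.Product using (Σ; _×_; ∃-syntax; _,_)
open import Relation.Nullary using (¬_; ⌊_⌋)
open import Data.Empty using (⊥)
open import Relation.Nullary.Decidable using (_×-dec_)
open import Relation.Binary.PropositionalEquality using (_≡_)

record Graph (n : ℕ) : Set₁ where
  field
    E      : Fin n → Fin n → Set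
    E-sym  : ∀ {u v} → E u v → E v u
    E-irr  : ∀ {u} → ¬ E u u
open Graph public

IsCycle : ∀ {m} → (Fin m → Fin m → Set) → List (Fin m) → Set
IsCycle R [] = ⊥
IsCycle R (x ∷ xs) = (3 ≤ length (x ∷ xs)) × Unique (x ∷ xs) × Linked R ((x ∷ xs) ++ [ x ])

-- A forest on the node set Fin m (a tree is a connected forest; the paper allows forests).
record Forest (m : ℕ) : Set₁ where
  field
    TE      : Fin m → Fin m → Set
    TE-sym  : ∀ {i j} → TE i j → TE j i
    TE-irr  : ∀ {i} → ¬ TE i i
    acyclic : ∀ (xs : List (Fin m)) → ¬ IsCycle TE xs
open Forest public

data WalkIn {m : ℕ} (T : Forest m) (P : Fin m → Set) : Fin m → Fin m → Set where
  here : ∀ {i} → P i → WalkIn T P i i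
  step : ∀ {i j k} → P i → TE T i j → WalkIn T P j k → WalkIn T P i k

ConnectedIn : ∀ {m} → Forest m → (Fin m → Set) → Set
ConnectedIn T P = ∀ i j → P i → P j → WalkIn T P i j

record TreeDecomposition {n : ℕ} (G : Graph n) (m : ℕ) : Set₁ where
  field
    bag       : Fin m → Subset n
    tree      : Forest m
    covers-v  : ∀ (v : Fin n) → ∃[ i ] (v ∈ bag i)
    covers-e  : ∀ (u v : Fin n) → E G u v → ∃[ i ] (u ∈ bag i × v ∈ bag i)
    coherent  : ∀ (v : Fin n) → ConnectedIn tree (λ i → v ∈ bag i)
open TreeDecomposition public

maxBagSize : ∀ {n m} {G : Graph n} → TreeDecomposition G m → ℕ
maxBagSize {m = m} D = foldr _⊔_ 0 (map (λ i → ∣ bag D i ∣) (allFin m))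

width : ∀ {n m} {G : Graph n} → TreeDecomposition G m → ℕ
width D = maxBagSize D ∸ 1

NonRepeated : ∀ {n m} {G : Graph n} → TreeDecomposition G m → Set
NonRepeated D = (∀ i → ∃[ v ] (v ∈ bag D i))
              × (∀ i j → TE (tree D) i j → ¬ (bag D i ⊆ bag D j))

unionBags : ∀ {n m} {G : Graph n} → TreeDecomposition G m → Subset m → Subset n
unionBags {m = m} D S = tabulate (λ v → ⌊ any? (λ i → (i ∈? S) ×-dec (v ∈? bag D i)) ⌋)

-- Upper bound: deleting the nodes of the subtree one by one, each bag adds at most h + 1
-- vertices to the union. Lower bound: delete a leaf ℓ of the subtree instead, which keeps it
-- connected. If ℓ has a neighbour p in the subtree, non-repetition gives a vertex v ∈ X_ℓ ∖ X_p;
-- since the bags containing v form a subtree and the forest is acyclic, v lies in no other bag of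
-- the subtree, so the union loses at least the vertex v, and induction concludes.
module Submission where

open import Defs
open import Data.Nat using (ℕ; suc; _+_; _*_; _⊔_; _≤_; _≤?_; z≤n; s≤s)
open import Data.Nat.Properties
  using (≤-reflexive; +-suc; ≤-trans; +-monoʳ-≤; +-mono-≤; +-comm; *-suc; m≤m⊔n; m≤n⇒m≤o⊔n; m≤n+m∸n; module ≤-Reasoning)
open import Data.Fin using (Fin; zero; suc; _≟_)
open import Data.Fin.Properties using (any?; sequence)
open import Data.Fin.Subset
  using (Subset; inside; outside; _∈_; _∉_; _⊆_; _⊂_; _⊃_; _∪_; _-_; ⁅_⁆; ∣_∣; Empty)
open import Data.Fin.Subset.Properties
  using (_∈?_; nonempty?; Empty-unique; ∣⊥∣≡0; p─⊥≡p; ∣p∣≤∣x∷p∣; p⊆q⇒∣p∣≤∣q∣; p⊂q⇒∣p∣<∣q∣; p─q⊆p;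
         x∈p∧x≢y⇒x∈p-y; x∈p⇒p-x⊂p; x∈p∪q⁺; x∈p∪q⁻; p⊆p∪q; x∈⁅x⁆; x∈⁅y⁆⇒x≡y)
open import Data.Fin.Subset.Induction using (Acc; acc; ⊂-wellFounded; ⊃-wellFounded)
open import Data.Vec using ([]; _∷_; here; there)
open import Data.Vec.Properties using ([]=⇒lookup; lookup⇒[]=; lookup∘tabulate)
open import Data.List using (List; []; _∷_; _++_; [_]; foldr)
open import Data.List.Membership.Propositional using () renaming (_∈_ to _∈ˡ_)
open import Data.List.Membership.Propositional.Properties using (∈-map⁺; ∈-allFin)
open import Data.List.Relation.Unary.Any using () renaming (here to hereˡ; there to thereˡ)
open import Data.List.Relation.Unary.All using (All; []; _∷_)
import Data.List.Relation.Unary.All as All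
open import Data.List.Relation.Unary.All.Properties using (¬Any⇒All¬)
open import Data.List.Relation.Unary.AllPairs using ([]; _∷_)
open import Data.List.Relation.Unary.Linked using (Linked; [-]; _∷_)
open import Data.List.Relation.Unary.Unique.Propositional using (Unique)
open import Data.Sum using (_⊎_; inj₁; inj₂)
open import Data.Product using (Σ; _×_; _,_; ∃-syntax; proj₁; proj₂; uncurry)
open import Data.Empty using (⊥-elim)
open import Effect.Monad using (RawMonad)
open import Data.Bool.Properties using (T-≡)
open import Function.Bundles using (Equivalence)
open import Relation.Nullary using (¬_; Dec; yes; no; ¬?)
open import Relation.Nullary.Decidable using (_×-dec_; decidable-stable; ¬¬-excluded-middle; toWitness; fromWitness)
open import Relation.Nullary.Negation using (¬¬-Monad)
open import Relation.Binary.PropositionalEquality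
  using (_≡_; _≢_; refl; sym; trans; cong; ≢-sym)

x∈p-y⇒x≢y : ∀ {k} {x y : Fin k} {p : Subset k} → x ∈ p - y → x ≢ y
x∈p-y⇒x≢y {x = zero}  {p = _ ∷ _} () refl
x∈p-y⇒x≢y {x = suc x} {p = _ ∷ _} (there x∈) refl = x∈p-y⇒x≢y x∈ refl

∣p∣≡1+∣p-x∣ : ∀ {k} {x : Fin k} {p : Subset k} → x ∈ p → ∣ p ∣ ≡ suc ∣ p - x ∣
∣p∣≡1+∣p-x∣ {x = zero}  {inside ∷ p}  here       = cong suc (sym (cong ∣_∣ (p─⊥≡p p)))
∣p∣≡1+∣p-x∣ {x = suc x} {inside ∷ p}  (there x∈) = cong suc (∣p∣≡1+∣p-x∣ x∈)
∣p∣≡1+∣p-x∣ {x = suc x} {outside ∷ p} (there x∈) = ∣p∣≡1+∣p-x∣ x∈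

∣p∪q∣≤∣p∣+∣q∣ : ∀ {k} (p q : Subset k) → ∣ p ∪ q ∣ ≤ ∣ p ∣ + ∣ q ∣
∣p∪q∣≤∣p∣+∣q∣ []            []            = z≤n
∣p∪q∣≤∣p∣+∣q∣ (inside ∷ p)  (s ∷ q)       =
  s≤s (≤-trans (∣p∪q∣≤∣p∣+∣q∣ p q) (+-monoʳ-≤ ∣ p ∣ (∣p∣≤∣x∷p∣ s q)))
∣p∪q∣≤∣p∣+∣q∣ (outside ∷ p) (inside ∷ q)  =
  ≤-trans (s≤s (∣p∪q∣≤∣p∣+∣q∣ p q)) (≤-reflexive (sym (+-suc ∣ p ∣ ∣ q ∣)))
∣p∪q∣≤∣p∣+∣q∣ (outside ∷ p) (outside ∷ q) = ∣p∪q∣≤∣p∣+∣q∣ p q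

p⊈q⇒∃p∖q : ∀ {k} {p q : Subset k} → ¬ (p ⊆ q) → ∃[ x ] (x ∈ p × x ∉ q)
p⊈q⇒∃p∖q {p = p} {q} p⊈q with any? (λ x → (x ∈? p) ×-dec ¬? (x ∈? q))
... | yes witness = witness
... | no none = ⊥-elim (p⊈q (λ {x} x∈p → decidable-stable (x ∈? q) (λ x∉q → none (x , x∈p , x∉q))))

∣Empty∣≡0 : ∀ {k} {p : Subset k} → Empty p → ∣ p ∣ ≡ 0
∣Empty∣≡0 {k} empty = trans (cong ∣_∣ (Empty-unique empty)) (∣⊥∣≡0 k)

x∈xs⇒x≤foldr-⊔ : ∀ {x} xs → x ∈ˡ xs → x ≤ foldr _⊔_ 0 xs
x∈xs⇒x≤foldr-⊔ (y ∷ xs) (hereˡ refl) = m≤m⊔n y _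
x∈xs⇒x≤foldr-⊔ (y ∷ xs) (thereˡ x∈) = m≤n⇒m≤o⊔n y (x∈xs⇒x≤foldr-⊔ xs x∈)

¬¬-decidable₂ : ∀ {k} (R : Fin k → Fin k → Set) → ¬ ¬ (∀ i j → Dec (R i j))
¬¬-decidable₂ R = sequence rawApplicative (λ i → sequence rawApplicative (λ j → ¬¬-excluded-middle))
  where open RawMonad ¬¬-Monad using (rawApplicative)

module Walks {m : ℕ} (T : Forest m) where

  open import Data.List.Membership.DecPropositional (_≟_ {m}) using () renaming (_∈?_ to _∈ˡ?_)

  walk-source : ∀ {P i j} → WalkIn T P i j → P i
  walk-source (here p)     = p
  walk-source (step p _ _) = p

  walk-target : ∀ {P i j} → WalkIn T P i j → P j
  walk-target (here p)     = p
  walk-target (step _ _ w) = walk-target w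

  walk-map : ∀ {P Q : Fin m → Set} {i j} → (∀ {x} → P x → Q x) → WalkIn T P i j → WalkIn T Q i j
  walk-map f (here p)     = here (f p)
  walk-map f (step p e w) = step (f p) e (walk-map f w)

  walk-++ : ∀ {P i j k} → WalkIn T P i j → WalkIn T P j k → WalkIn T P i k
  walk-++ (here _)     w′ = w′
  walk-++ (step p e w) w′ = step p e (walk-++ w w′)

  linked⇒walk : ∀ {P : Fin m → Set} {x z} xs → Linked (TE T) (x ∷ xs) → All P (x ∷ xs) → z ∈ˡ x ∷ xs
              → WalkIn T P x z
  linked⇒walk xs       _       (px ∷ _)  (hereˡ refl) = here px
  linked⇒walk (y ∷ xs) (e ∷ l) (px ∷ ps) (thereˡ z∈)  = step px e (linked⇒walk xs l ps z∈)

  inner : ∀ {P i j} → WalkIn T P i j → List (Fin m)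
  inner (here _)             = []
  inner (step {j = j} _ _ w) = j ∷ inner w

  nodes : ∀ {P i j} → WalkIn T P i j → List (Fin m)
  nodes {i = i} w = i ∷ inner w

  nodes-All : ∀ {P i j} (w : WalkIn T P i j) → All P (nodes w)
  nodes-All (here p)     = p ∷ []
  nodes-All (step p _ w) = p ∷ nodes-All w

  nodes-Linked : ∀ {P i j k} (w : WalkIn T P i j) → TE T j k → Linked (TE T) (nodes w ++ [ k ])
  nodes-Linked (here _)     e′ = e′ ∷ [-]
  nodes-Linked (step _ e w) e′ = e ∷ nodes-Linked w e′

  SimpleWalk : (Fin m → Set) → Fin m → Fin m → Set
  SimpleWalk P i j = Σ (WalkIn T P i j) (λ w → Unique (nodes w))

  simple-suffix : ∀ {P i j k} (w : WalkIn T P i j) → Unique (nodes w) → k ∈ˡ nodes w → SimpleWalk P k j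
  simple-suffix w            u       (hereˡ refl) = w , u
  simple-suffix (step _ _ w) (_ ∷ u) (thereˡ k∈)  = simple-suffix w u k∈

  simplify : ∀ {P i j} → WalkIn T P i j → SimpleWalk P i j
  simplify (here p) = here p , [] ∷ []
  simplify {i = i} (step p e w) with simplify w
  ... | w′ , u with i ∈ˡ? nodes w′
  ...   | yes i∈ = simple-suffix w′ u i∈
  ...   | no  i∉ = step p e w′ , ¬Any⇒All¬ _ i∉ ∷ u

  -- Shortened to a simple walk, w would close a cycle through ℓ.
  neighbours-disconnected : ∀ {ℓ a b} → TE T ℓ a → TE T ℓ b → a ≢ b → ¬ WalkIn T (_≢ ℓ) a b
  neighbours-disconnected {ℓ} ea eb a≢b w with simplify w
  ... | here _ , _ = a≢b refl
  ... | w′@(step _ _ _) , u =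
    acyclic T (ℓ ∷ nodes w′)
      (s≤s (s≤s (s≤s z≤n)) , All.map ≢-sym (nodes-All w′) ∷ u , ea ∷ nodes-Linked w′ (TE-sym T eb))

  last-exit : ∀ {P ℓ x j} → WalkIn T P x j → j ≢ ℓ
            → WalkIn T (λ z → P z × z ≢ ℓ) x j ⊎ ∃[ q ] (TE T ℓ q × WalkIn T (λ z → P z × z ≢ ℓ) q j)
  last-exit (here p) j≢ℓ = inj₁ (here (p , j≢ℓ))
  last-exit {ℓ = ℓ} {x} (step {j = y} p e w) j≢ℓ with last-exit w j≢ℓ
  ... | inj₂ exit = inj₂ exit
  ... | inj₁ w′ with x ≟ ℓ
  ...   | yes refl = inj₂ (y , e , w′)
  ...   | no  x≢ℓ  = inj₁ (step (p , x≢ℓ) e w′)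

  leave : ∀ {P ℓ j} → WalkIn T P ℓ j → j ≢ ℓ → ∃[ q ] (TE T ℓ q × WalkIn T (λ z → P z × z ≢ ℓ) q j)
  leave w j≢ℓ with last-exit w j≢ℓ
  ... | inj₁ w′  = ⊥-elim (proj₂ (walk-source w′) refl)
  ... | inj₂ exit = exit

  first-entry : ∀ {P ℓ x} → WalkIn T P x ℓ → x ≢ ℓ
              → ∃[ q ] (TE T q ℓ × WalkIn T (λ z → P z × z ≢ ℓ) x q)
  first-entry (here _) x≢ℓ = ⊥-elim (x≢ℓ refl)
  first-entry {ℓ = ℓ} {x} (step {j = y} p e w) x≢ℓ with y ≟ ℓ
  ... | yes refl = x , e , here (p , x≢ℓ)
  ... | no  y≢ℓ  = let q , eq , w′ = first-entry w y≢ℓ in q , eq , step (p , x≢ℓ) e w′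

  IsLeafIn : Subset m → Fin m → Set
  IsLeafIn S ℓ = ∀ {p q} → p ∈ S → q ∈ S → TE T ℓ p → TE T ℓ q → p ≡ q

  connected-minus-leaf : ∀ {S ℓ} → ConnectedIn T (_∈ S) → ℓ ∈ S → IsLeafIn S ℓ → ConnectedIn T (_∈ S - ℓ)
  connected-minus-leaf {S} {ℓ} conn ℓ∈S leaf i j i∈ j∈
    with last-exit (conn i j (p─q⊆p S ⁅ ℓ ⁆ i∈) (p─q⊆p S ⁅ ℓ ⁆ j∈)) (x∈p-y⇒x≢y j∈)
  ... | inj₁ w = walk-map (uncurry x∈p∧x≢y⇒x∈p-y) w
  ... | inj₂ (q , eℓq , w) with first-entry (conn i ℓ (p─q⊆p S ⁅ ℓ ⁆ i∈) ℓ∈S) (x∈p-y⇒x≢y i∈)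
  ...   | q′ , eq′ℓ , w′ with leaf (proj₁ (walk-target w′)) (proj₁ (walk-source w)) (TE-sym T eq′ℓ) eℓq
  ...     | refl = walk-map (uncurry x∈p∧x≢y⇒x∈p-y) (walk-++ w′ w)

module Leaves {m : ℕ} (T : Forest m) (adj? : ∀ i j → Dec (TE T i j)) (S : Subset m) where

  open Walks T
  open import Data.List.Membership.DecPropositional (_≟_ {m}) using () renaming (_∈?_ to _∈ˡ?_)

  -- An S-neighbour of x further along the path than y would close a cycle through x.
  stuck⇒leaf : ∀ x rest → Linked (TE T) (x ∷ rest) → All (x ≢_) rest
             → (∀ {z} → z ∈ S → TE T x z → z ∈ˡ rest) → IsLeafIn S x
  stuck⇒leaf x []         _          _        on-path p∈ _ exp _ with on-path p∈ exp
  ... | ()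
  stuck⇒leaf x (y ∷ rest) (exy ∷ l) x≢rest on-path p∈ q∈ exp exq =
    trans (neighbour≡y p∈ exp) (sym (neighbour≡y q∈ exq))
    where
      neighbour≡y : ∀ {z} → z ∈ S → TE T x z → z ≡ y
      neighbour≡y {z} z∈ exz with z ≟ y
      ... | yes z≡y = z≡y
      ... | no  z≢y = ⊥-elim (neighbours-disconnected exy exz (≢-sym z≢y)
                        (linked⇒walk rest l (All.map ≢-sym x≢rest) (on-path z∈ exz)))

  -- Extends the path at its head while x has a fresh S-neighbour; this terminates because the
  -- visited set V grows strictly.
  grow : ∀ x rest (V : Subset m) → Acc _⊃_ V → (∀ {z} → z ∈ V → z ∈ˡ x ∷ rest)
       → Linked (TE T) (x ∷ rest) → All (_∈ S) (x ∷ rest) → All (x ≢_) rest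
       → ∃[ ℓ ] (ℓ ∈ S × IsLeafIn S ℓ)
  grow x rest V (acc more) V⊆path l inS x≢rest
    with any? (λ q → (q ∈? S) ×-dec (adj? x q ×-dec ¬? (q ∈ˡ? x ∷ rest)))
  ... | yes (q , q∈S , exq , q∉) =
    grow q (x ∷ rest) (V ∪ ⁅ q ⁆) (more V⊂V∪q) V∪q⊆path (TE-sym T exq ∷ l) (q∈S ∷ inS) (¬Any⇒All¬ _ q∉)
    where
      V⊂V∪q : V ⊂ V ∪ ⁅ q ⁆
      V⊂V∪q = p⊆p∪q ⁅ q ⁆ , q , x∈p∪q⁺ (inj₂ (x∈⁅x⁆ q)) , (λ q∈V → q∉ (V⊆path q∈V))
      V∪q⊆path : ∀ {z} → z ∈ V ∪ ⁅ q ⁆ → z ∈ˡ q ∷ x ∷ rest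
      V∪q⊆path {z} z∈ with x∈p∪q⁻ V ⁅ q ⁆ z∈
      ... | inj₁ z∈V = thereˡ (V⊆path z∈V)
      ... | inj₂ z∈q = hereˡ (x∈⁅y⁆⇒x≡y q z∈q)
  ... | no stuck = x , All.head inS , stuck⇒leaf x rest l x≢rest on-path
    where
      on-path : ∀ {z} → z ∈ S → TE T x z → z ∈ˡ rest
      on-path {z} z∈S exz with decidable-stable (z ∈ˡ? x ∷ rest) (λ z∉ → stuck (z , z∈S , exz , z∉))
      ... | hereˡ refl = ⊥-elim (TE-irr T exz)
      ... | thereˡ z∈  = z∈

  leaf-exists : ∀ {x} → x ∈ S → ∃[ ℓ ] (ℓ ∈ S × IsLeafIn S ℓ)
  leaf-exists {x} x∈S =
    grow x [] ⁅ x ⁆ (⊃-wellFounded ⁅ x ⁆) (λ z∈ → hereˡ (x∈⁅y⁆⇒x≡y x z∈)) [-] (x∈S ∷ []) []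

module _ {n m : ℕ} {G : Graph n} (D : TreeDecomposition G m) where

  open Walks (tree D)

  ∈unionBags⁻ : ∀ {S v} → v ∈ unionBags D S → ∃[ i ] (i ∈ S × v ∈ bag D i)
  ∈unionBags⁻ {S} {v} v∈ =
    toWitness (Equivalence.from T-≡ (trans (sym (lookup∘tabulate _ v)) ([]=⇒lookup v∈)))

  ∈unionBags⁺ : ∀ {S v i} → i ∈ S → v ∈ bag D i → v ∈ unionBags D S
  ∈unionBags⁺ {S} {v} {i} i∈S v∈ =
    lookup⇒[]= v _ (trans (lookup∘tabulate _ v) (Equivalence.to T-≡ (fromWitness (i , i∈S , v∈))))

  unionBags-Empty : ∀ {S} → Empty S → Empty (unionBags D S)
  unionBags-Empty empty (v , v∈) = let i , i∈S , _ = ∈unionBags⁻ v∈ in empty (i , i∈S)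

  unionBags-minus : ∀ {S} ℓ → unionBags D (S - ℓ) ⊆ unionBags D S
  unionBags-minus {S} ℓ v∈ = let i , i∈ , v∈i = ∈unionBags⁻ v∈ in ∈unionBags⁺ (p─q⊆p S ⁅ ℓ ⁆ i∈) v∈i

  unionBags-split : ∀ {S} ℓ → unionBags D S ⊆ unionBags D (S - ℓ) ∪ bag D ℓ
  unionBags-split ℓ v∈ with ∈unionBags⁻ v∈
  ... | i , i∈S , v∈i with i ≟ ℓ
  ...   | yes refl = x∈p∪q⁺ (inj₂ v∈i)
  ...   | no  i≢ℓ  = x∈p∪q⁺ (inj₁ (∈unionBags⁺ (x∈p∧x≢y⇒x∈p-y i∈S i≢ℓ) v∈i))

  ∣unionBags∣≤ : ∀ {b} → (∀ i → ∣ bag D i ∣ ≤ b) → ∀ S → ∣ unionBags D S ∣ ≤ b * ∣ S ∣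
  ∣unionBags∣≤ {b} bound S = go S (⊂-wellFounded S)
    where
      open ≤-Reasoning
      go : ∀ S → Acc _⊂_ S → ∣ unionBags D S ∣ ≤ b * ∣ S ∣
      go S (acc smaller) with nonempty? S
      ... | no  empty     = ≤-trans (≤-reflexive (∣Empty∣≡0 (unionBags-Empty empty))) z≤n
      ... | yes (ℓ , ℓ∈S) = begin
        ∣ unionBags D S ∣                     ≤⟨ p⊆q⇒∣p∣≤∣q∣ (unionBags-split ℓ) ⟩
        ∣ unionBags D (S - ℓ) ∪ bag D ℓ ∣     ≤⟨ ∣p∪q∣≤∣p∣+∣q∣ (unionBags D (S - ℓ)) (bag D ℓ) ⟩
        ∣ unionBags D (S - ℓ) ∣ + ∣ bag D ℓ ∣ ≤⟨ +-mono-≤ (go (S - ℓ) (smaller (x∈p⇒p-x⊂p ℓ∈S))) (bound ℓ) ⟩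
        b * ∣ S - ℓ ∣ + b                     ≡⟨ +-comm (b * ∣ S - ℓ ∣) b ⟩
        b + b * ∣ S - ℓ ∣                     ≡⟨ sym (*-suc b ∣ S - ℓ ∣) ⟩
        b * suc ∣ S - ℓ ∣                     ≡⟨ cong (b *_) (sym (∣p∣≡1+∣p-x∣ ℓ∈S)) ⟩
        b * ∣ S ∣                             ∎

  module _ (non-repeated : NonRepeated D) (adj? : ∀ i j → Dec (TE (tree D) i j)) where

    -- With v ∈ X_ℓ ∖ X_p, a bag X_j ∋ v with j ∈ S - ℓ is reached from ℓ through a neighbour
    -- q ≠ p, and then q ⇝ j ⇝ p avoids ℓ.
    private-vertex : ∀ {S ℓ} → ConnectedIn (tree D) (_∈ S) → ℓ ∈ S → IsLeafIn S ℓ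
                   → ∃[ v ] (v ∈ bag D ℓ × ∀ {j} → j ∈ S - ℓ → v ∉ bag D j)
    private-vertex {S} {ℓ} conn ℓ∈S leaf with any? (λ p → (p ∈? S) ×-dec adj? ℓ p)
    ... | no isolated =
      let v , v∈ℓ = proj₁ non-repeated ℓ in
      v , v∈ℓ , λ {j} j∈ _ →
        let q , eℓq , w = leave (conn ℓ j ℓ∈S (p─q⊆p S ⁅ ℓ ⁆ j∈)) (x∈p-y⇒x≢y j∈)
        in isolated (q , proj₁ (walk-source w) , eℓq)
    ... | yes (p , p∈S , eℓp) with p⊈q⇒∃p∖q (proj₂ non-repeated ℓ p eℓp)
    ... | v , v∈ℓ , v∉p = v , v∈ℓ , v∉
      where
        p≢ℓ : p ≢ ℓ
        p≢ℓ refl = TE-irr (tree D) eℓp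
        v∈q⇒q≢p : ∀ {q} → v ∈ bag D q → q ≢ p
        v∈q⇒q≢p v∈q refl = v∉p v∈q
        v∉ : ∀ {j} → j ∈ S - ℓ → v ∉ bag D j
        v∉ {j} j∈ v∈j with leave (coherent D v ℓ j v∈ℓ v∈j) (x∈p-y⇒x≢y j∈)
        ... | q , eℓq , q⇝j =
          neighbours-disconnected eℓq eℓp (v∈q⇒q≢p (proj₁ (walk-source q⇝j)))
            (walk-++ (walk-map proj₂ q⇝j) (walk-map x∈p-y⇒x≢y j⇝p))
          where
            j⇝p : WalkIn (tree D) (_∈ S - ℓ) j p
            j⇝p = connected-minus-leaf conn ℓ∈S leaf j p j∈ (x∈p∧x≢y⇒x∈p-y p∈S p≢ℓ)

    ∣S∣≤∣unionBags∣ : ∀ S → ConnectedIn (tree D) (_∈ S) → ∣ S ∣ ≤ ∣ unionBags D S ∣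
    ∣S∣≤∣unionBags∣ S = go S (⊂-wellFounded S)
      where
        open ≤-Reasoning
        go : ∀ S → Acc _⊂_ S → ConnectedIn (tree D) (_∈ S) → ∣ S ∣ ≤ ∣ unionBags D S ∣
        go S (acc smaller) conn with nonempty? S
        ... | no  empty     = ≤-trans (≤-reflexive (∣Empty∣≡0 empty)) z≤n
        ... | yes (x , x∈S) with Leaves.leaf-exists (tree D) adj? S x∈S
        ... | ℓ , ℓ∈S , leaf = begin
          ∣ S ∣                        ≡⟨ ∣p∣≡1+∣p-x∣ ℓ∈S ⟩
          suc ∣ S - ℓ ∣                ≤⟨ s≤s induction-hypothesis ⟩
          suc ∣ unionBags D (S - ℓ) ∣  ≤⟨ p⊂q⇒∣p∣<∣q∣ shrinks ⟩
          ∣ unionBags D S ∣            ∎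
          where
            induction-hypothesis : ∣ S - ℓ ∣ ≤ ∣ unionBags D (S - ℓ) ∣
            induction-hypothesis =
              go (S - ℓ) (smaller (x∈p⇒p-x⊂p ℓ∈S)) (connected-minus-leaf conn ℓ∈S leaf)
            shrinks : unionBags D (S - ℓ) ⊂ unionBags D S
            shrinks with private-vertex conn ℓ∈S leaf
            ... | v , v∈ℓ , v∉ =
              unionBags-minus ℓ , v , ∈unionBags⁺ ℓ∈S v∈ℓ ,
              λ v∈ → let j , j∈ , v∈j = ∈unionBags⁻ v∈ in v∉ j∈ v∈j

lemma4 : ∀ {n m : ℕ} (G : Graph n) (D : TreeDecomposition G m) (h : ℕ)
         → NonRepeated D → width D ≡ h
         → (S : Subset m) → ConnectedIn (tree D) (λ i → i ∈ S)
         → (∣ unionBags D S ∣ ≤ suc h * ∣ S ∣) × (∣ S ∣ ≤ ∣ unionBags D S ∣)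
lemma4 G D h non-repeated width≡h S conn = ∣unionBags∣≤ D bag-bound S , lower-bound
  where
    open ≤-Reasoning
    bag-bound : ∀ i → ∣ bag D i ∣ ≤ suc h
    bag-bound i = begin
      ∣ bag D i ∣          ≤⟨ x∈xs⇒x≤foldr-⊔ _ (∈-map⁺ (λ i → ∣ bag D i ∣) (∈-allFin i)) ⟩
      maxBagSize D        ≤⟨ m≤n+m∸n (maxBagSize D) 1 ⟩
      suc (width D)       ≡⟨ cong suc width≡h ⟩
      suc h               ∎
    -- The lower bound is decidable, so it may be proved under the ¬¬-valid assumption that
    -- adjacency in the forest is decidable.
    lower-bound : ∣ S ∣ ≤ ∣ unionBags D S ∣
    lower-bound = decidable-stable (∣ S ∣ ≤? ∣ unionBags D S ∣) λ ≰ →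
      ¬¬-decidable₂ (TE (tree D)) (λ adj? → ≰ (∣S∣≤∣unionBags∣ D non-repeated adj? S conn))
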